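{- Let $A,B$ be positive integers with decimal expansions $A=\sum_{i=0}^{a} a_i 10^i$ and $B=\sum_{k=0}^{b} b_k 10^k$. The following assertions are equivalent: 1) $(A,B)$ is a polynomial pair, i.e. $P(A,x)P(B,x)=P(A\times B,x)$; 2) the (schoolbook, base $10$) multiplication of $A$ by $B$ can be performed without any carry; 3) every coefficient of the polynomial $P(A,x)P(B,x)$ is at most $9$, i.e. $\sum_{i+k=j} a_i b_k\le 9$ for every $j$.
   Context: For a positive integer $A$ with decimal representation $A=\sum_{i=0}^{a} a_i 10^i$ (digits $a_i\in\{0,\dots,9\}$, $a_a\neq 0$), define the polynomial $P(A,x)=\sum_{i=0}^{a} a_i x^i\in\mathbb{Q}[x]$, so that $P(A,10)=A$. A pair $(A,B)$ of positive integers is called a polynomial pair if $P(A,x)P(B,x)=P(A\times B,x)$. -}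

module Defs where

open import Data.Nat using (ℕ; zero; suc; _+_; _*_; _∸_; _/_; _%_; _≤_)
open import Data.List using (List; map; upTo)
open import Data.Nat.ListAction using (sum)
open import Data.Product using (_×_)
open import Relation.Binary.PropositionalEquality using (_≡_)

-- i-th decimal digit of A (coefficient of x^i in P(A,x)); 0 for i beyond the top digit.
digit : ℕ → ℕ → ℕ
digit A zero    = A % 10
digit A (suc i) = digit (A / 10) i

-- A polynomial in Q[x] with natural coefficients is represented by its
-- (finitely supported) coefficient sequence ℕ → ℕ; P(A,x) is `digit A`.
conv : (ℕ → ℕ) → (ℕ → ℕ) → ℕ → ℕ
conv f g j = sum (map (λ i → f i * g (j ∸ i)) (upTo (suc j)))

PolynomialPair : ℕ → ℕ → Set
PolynomialPair A B = ∀ j → conv (digit A) (digit B) j ≡ digit (A * B) j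

-- 2) Schoolbook base-10 multiplication of A by B.
-- Partial product row k = A × b_k, computed digit by digit from the right:
-- rowCarry A B k i is the carry entering position i of row k.
rowCarry : ℕ → ℕ → ℕ → ℕ → ℕ
rowCarry A B k zero    = 0
rowCarry A B k (suc i) = (digit A i * digit B k + rowCarry A B k i) / 10

-- digit written at position i of row k (row k itself is then shifted k places left)
rowDigit : ℕ → ℕ → ℕ → ℕ → ℕ
rowDigit A B k i = (digit A i * digit B k + rowCarry A B k i) % 10

-- column j of the addition of the shifted rows: Σ_{k ≤ j} rowDigit k (j - k)
columnSum : ℕ → ℕ → ℕ → ℕ
columnSum A B j = sum (map (λ k → rowDigit A B k (j ∸ k)) (upTo (suc j)))

addCarry : ℕ → ℕ → ℕ → ℕ
addCarry A B zero    = 0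
addCarry A B (suc j) = (columnSum A B j + addCarry A B j) / 10

NoCarry : ℕ → ℕ → Set
NoCarry A B = (∀ k i → rowCarry A B k i ≡ 0) × (∀ j → addCarry A B j ≡ 0)

CoeffsAtMost9 : ℕ → ℕ → Set
CoeffsAtMost9 A B = ∀ j → conv (digit A) (digit B) j ≤ 9

module Submission where

-- Identify a number with its digit sequence (`digit A`) and a
-- polynomial with its coefficient sequence; `conv` is the product of two
-- such sequences.  The whole theorem reduces to two facts:
--
--  * Carry-free arithmetic: if every coefficient of P(A,x)P(B,x) is ≤ 9,
--    then these coefficients ARE the digits of A×B.  Writing
--    A = a₀ + 10·A', we have A·B = a₀·B + 10·(A'·B); the digits of a₀·B and
--    of 10·(A'·B) are (by induction on A) the coefficients of a₀·P(B,x) and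
--    x·P(A',x)P(B,x), which add up to P(A,x)P(B,x) without carries.
--  * A carry sequence c(j+1) = (s(j) + c(j)) / 10 with c(0) = 0 vanishes
--    identically iff every column value s(j) is ≤ 9.  Applied to each row
--    of the schoolbook multiplication this says the rows are carry-free iff
--    every digit product aᵢbₖ is ≤ 9; in that case the column sums are the
--    coefficients of P(A,x)P(B,x), and applied to the final addition it
--    says this addition is carry-free iff those coefficients are ≤ 9.

open import Defs
open import Data.Nat using (ℕ; zero; suc; _+_; _*_; _∸_; _/_; _%_; _≤_; _<_; s≤s; z≤n)
open import Data.Nat.Properties
open import Data.Nat.DivMod
open import Data.Nat.Induction using (<-rec)
open import Data.Nat.ListAction using (sum)
open import Data.Nat.ListAction.Properties using (sum-++)
open import Data.List using (applyUpTo; _++_)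
open import Data.List.Properties using (applyUpTo-∷ʳ; map-upTo)
open import Data.Product using (_×_; _,_)
open import Function using (_∘_)
open import Function.Bundles using (_⇔_; mk⇔; module Equivalence)
open import Function.Properties.Equivalence using () renaming (trans to ⇔-trans; sym to ⇔-sym)
open import Relation.Binary.PropositionalEquality
open ≡-Reasoning

sum-applyUpTo-last : ∀ (h : ℕ → ℕ) n → sum (applyUpTo h (suc n)) ≡ sum (applyUpTo h n) + h n
sum-applyUpTo-last h n = begin
  sum (applyUpTo h (suc n))          ≡⟨ cong sum (applyUpTo-∷ʳ h n) ⟨
  sum (applyUpTo h n ++ _)           ≡⟨ sum-++ (applyUpTo h n) _ ⟩
  sum (applyUpTo h n) + (h n + 0)    ≡⟨ cong (sum (applyUpTo h n) +_) (+-identityʳ (h n)) ⟩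
  sum (applyUpTo h n) + h n          ∎

sum-applyUpTo-cong : ∀ n (h h′ : ℕ → ℕ) → (∀ i → i < n → h i ≡ h′ i) →
  sum (applyUpTo h n) ≡ sum (applyUpTo h′ n)
sum-applyUpTo-cong zero    h h′ eq = refl
sum-applyUpTo-cong (suc n) h h′ eq =
  cong₂ _+_ (eq 0 (s≤s z≤n)) (sum-applyUpTo-cong n (h ∘ suc) (h′ ∘ suc) (λ i i<n → eq (suc i) (s≤s i<n)))

sum-applyUpTo-reverse : ∀ n (h : ℕ → ℕ) →
  sum (applyUpTo h n) ≡ sum (applyUpTo (λ k → h (n ∸ suc k)) n)
sum-applyUpTo-reverse zero    h = refl
sum-applyUpTo-reverse (suc n) h = begin
  sum (applyUpTo h (suc n))                            ≡⟨ sum-applyUpTo-last h n ⟩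
  sum (applyUpTo h n) + h n                            ≡⟨ cong (_+ h n) (sum-applyUpTo-reverse n h) ⟩
  sum (applyUpTo (λ k → h (n ∸ suc k)) n) + h n        ≡⟨ +-comm _ (h n) ⟩
  h n + sum (applyUpTo (λ k → h (n ∸ suc k)) n)        ∎

conv-as-sum : ∀ f g j → conv f g j ≡ sum (applyUpTo (λ i → f i * g (j ∸ i)) (suc j))
conv-as-sum f g j = cong sum (map-upTo (λ i → f i * g (j ∸ i)) (suc j))

-- Multiplication by x on coefficient sequences.
shift : (ℕ → ℕ) → ℕ → ℕ
shift h zero    = 0
shift h (suc j) = h j

-- Horner step: f·g = f₀·g + x·((f - f₀)/x)·g, coefficientwise.
conv-unfold : ∀ f g j → conv f g j ≡ f 0 * g j + shift (conv (λ i → f (suc i)) g) j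
conv-unfold f g zero    = refl
conv-unfold f g (suc j) =
  trans (conv-as-sum f g (suc j)) (cong (f 0 * g (suc j) +_) (sym (conv-as-sum (λ i → f (suc i)) g j)))

-- Convolution is commutative: reverse the order of summation.
conv-comm : ∀ f g j → conv f g j ≡ conv g f j
conv-comm f g j = begin
  conv f g j                                                   ≡⟨ conv-as-sum f g j ⟩
  sum (applyUpTo (λ i → f i * g (j ∸ i)) (suc j))              ≡⟨ sum-applyUpTo-reverse (suc j) (λ i → f i * g (j ∸ i)) ⟩
  sum (applyUpTo (λ k → f (j ∸ k) * g (j ∸ (j ∸ k))) (suc j))  ≡⟨ sum-applyUpTo-cong (suc j) _ _ swap ⟩
  sum (applyUpTo (λ k → g k * f (j ∸ k)) (suc j))              ≡⟨ conv-as-sum g f j ⟨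
  conv g f j                                                   ∎
  where
  swap : ∀ k → k < suc j → f (j ∸ k) * g (j ∸ (j ∸ k)) ≡ g k * f (j ∸ k)
  swap k (s≤s k≤j) = trans (cong (λ m → f (j ∸ k) * g m) (m∸[m∸n]≡n k≤j)) (*-comm (f (j ∸ k)) (g k))

conv-zeroˡ : ∀ f g → (∀ i → f i ≡ 0) → ∀ j → conv f g j ≡ 0
conv-zeroˡ f g f≡0 zero    rewrite f≡0 0 = refl
conv-zeroˡ f g f≡0 (suc j) rewrite conv-unfold f g (suc j) | f≡0 0 =
  conv-zeroˡ (λ i → f (suc i)) g (λ i → f≡0 (suc i)) j

term≤conv : ∀ f g i k → f i * g k ≤ conv f g (i + k)
term≤conv f g zero    k rewrite conv-unfold f g k = m≤m+n (f 0 * g k) _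
term≤conv f g (suc i) k rewrite conv-unfold f g (suc (i + k)) =
  ≤-trans (term≤conv (λ i → f (suc i)) g i k) (m≤n+m _ (f 0 * g (suc (i + k))))

digit-zero : ∀ j → digit 0 j ≡ 0
digit-zero zero    = refl
digit-zero (suc j) = digit-zero j

-- Digits are single digits: this is why a polynomial pair has coefficients ≤ 9.
digit≤9 : ∀ X j → digit X j ≤ 9
digit≤9 X zero    = ≤-pred (m%n<n X 10)
digit≤9 X (suc j) = digit≤9 (X / 10) j

digit-+ : ∀ X Y → (∀ i → digit X i + digit Y i ≤ 9) → ∀ j → digit (X + Y) j ≡ digit X j + digit Y j
digit-+ X Y bound zero    = trans (%-distribˡ-+ X Y 10) (m<n⇒m%n≡m (s≤s (bound 0)))
digit-+ X Y bound (suc j) rewrite +-distrib-/ X Y {10} (s≤s (bound 0)) =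
  digit-+ (X / 10) (Y / 10) (λ i → bound (suc i)) j

digit-10* : ∀ Y j → digit (10 * Y) j ≡ shift (digit Y) j
digit-10* Y zero    rewrite *-comm 10 Y = m*n%n≡0 Y 10
digit-10* Y (suc j) rewrite *-comm 10 Y = cong (λ m → digit m j) (m*n/n≡m Y 10)

-- Multiplication by a single digit without carries (a·B as B + ... + B).
digit-scale : ∀ a B → (∀ k → a * digit B k ≤ 9) → ∀ k → digit (a * B) k ≡ a * digit B k
digit-scale zero    B bound k = digit-zero k
digit-scale (suc a) B bound k = begin
  digit (B + a * B) k           ≡⟨ digit-+ B (a * B) bound′ k ⟩
  digit B k + digit (a * B) k   ≡⟨ cong (digit B k +_) (digit-scale a B smaller k) ⟩
  digit B k + a * digit B k     ∎
  where
  smaller : ∀ k → a * digit B k ≤ 9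
  smaller k = ≤-trans (m≤n+m _ (digit B k)) (bound k)
  bound′ : ∀ i → digit B i + digit (a * B) i ≤ 9
  bound′ i rewrite digit-scale a B smaller i = bound i

product-split : ∀ A B → A * B ≡ A % 10 * B + 10 * (A / 10 * B)
product-split A B = begin
  A * B                              ≡⟨ cong (_* B) (m≡m%n+[m/n]*n A 10) ⟩
  (A % 10 + A / 10 * 10) * B         ≡⟨ *-distribʳ-+ B (A % 10) (A / 10 * 10) ⟩
  A % 10 * B + A / 10 * 10 * B       ≡⟨ cong (λ m → A % 10 * B + m * B) (*-comm (A / 10) 10) ⟩
  A % 10 * B + 10 * (A / 10) * B     ≡⟨ cong (A % 10 * B +_) (*-assoc 10 (A / 10) B) ⟩
  A % 10 * B + 10 * (A / 10 * B)     ∎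

CarryFreeProducts : ℕ → Set
CarryFreeProducts A = ∀ B → CoeffsAtMost9 A B → ∀ j → digit (A * B) j ≡ conv (digit A) (digit B) j

coeffs≤9⇒digits : ∀ A → CarryFreeProducts A
coeffs≤9⇒digits = <-rec CarryFreeProducts step
  where
  step : ∀ A → (∀ {A′} → A′ < A → CarryFreeProducts A′) → CarryFreeProducts A
  step zero      ih B c j = trans (digit-zero j) (sym (conv-zeroˡ (digit 0) (digit B) digit-zero j))
  step A@(suc _) ih B c j = begin
    digit (A * B) j               ≡⟨ cong (λ m → digit m j) (product-split A B) ⟩
    digit (X + Y) j               ≡⟨ digit-+ X Y (λ i → subst (_≤ 9) (sym (pieces i)) (c i)) j ⟩
    digit X j + digit Y j         ≡⟨ pieces j ⟩
    conv (digit A) (digit B) j    ∎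
    where
    X = A % 10 * B
    Y = 10 * (A / 10 * B)
    -- the coefficients of a₀·P(B,x) and of P(A',x)P(B,x) are bounded by those of P(A,x)P(B,x)
    a₀-bound : ∀ k → A % 10 * digit B k ≤ 9
    a₀-bound k = ≤-trans (term≤conv (digit A) (digit B) 0 k) (c k)
    A′-bound : CoeffsAtMost9 (A / 10) B
    A′-bound i = ≤-trans (m≤n+m _ (A % 10 * digit B (suc i)))
                         (subst (_≤ 9) (conv-unfold (digit A) (digit B) (suc i)) (c (suc i)))
    digits-A′B : ∀ i → digit (A / 10 * B) i ≡ conv (digit (A / 10)) (digit B) i
    digits-A′B = ih (m/n<m A 10 (s≤s (s≤s z≤n))) B A′-bound
    pieces : ∀ i → digit X i + digit Y i ≡ conv (digit A) (digit B) i
    pieces i = begin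
      digit X i + digit Y i                                              ≡⟨ cong₂ _+_ (digit-scale (A % 10) B a₀-bound i) (digit-10* (A / 10 * B) i) ⟩
      A % 10 * digit B i + shift (digit (A / 10 * B)) i                  ≡⟨ cong (A % 10 * digit B i +_) (shift-cong i) ⟩
      A % 10 * digit B i + shift (conv (digit (A / 10)) (digit B)) i     ≡⟨ conv-unfold (digit A) (digit B) i ⟨
      conv (digit A) (digit B) i                                         ∎
      where
      shift-cong : ∀ i → shift (digit (A / 10 * B)) i ≡ shift (conv (digit (A / 10)) (digit B)) i
      shift-cong zero    = refl
      shift-cong (suc i) = digits-A′B i

polynomialPair⇔coeffs≤9 : ∀ A B → PolynomialPair A B ⇔ CoeffsAtMost9 A B
polynomialPair⇔coeffs≤9 A B = mk⇔
  (λ pp j → subst (_≤ 9) (sym (pp j)) (digit≤9 (A * B) j))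
  (λ c j → sym (coeffs≤9⇒digits A B c j))

IsCarrySequence : (s c : ℕ → ℕ) → Set
IsCarrySequence s c = c 0 ≡ 0 × (∀ j → c (suc j) ≡ (s j + c j) / 10)

carry-free⇔columns≤9 : ∀ {s c} → IsCarrySequence s c → (∀ j → c j ≡ 0) ⇔ (∀ j → s j ≤ 9)
carry-free⇔columns≤9 {s} {c} (c₀ , cₛ) = mk⇔ columns≤9 carry-free
  where
  columns≤9 : (∀ j → c j ≡ 0) → ∀ j → s j ≤ 9
  columns≤9 c≡0 j = ≤-pred (subst (_< 10) (+-identityʳ (s j))
    (m/n≡0⇒m<n (trans (cong (λ m → (s j + m) / 10) (sym (c≡0 j))) (trans (sym (cₛ j)) (c≡0 (suc j))))))
  carry-free : (∀ j → s j ≤ 9) → ∀ j → c j ≡ 0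
  carry-free s≤9 zero    = c₀
  carry-free s≤9 (suc j) = begin
    c (suc j)          ≡⟨ cₛ j ⟩
    (s j + c j) / 10   ≡⟨ cong (λ m → (s j + m) / 10) (carry-free s≤9 j) ⟩
    (s j + 0) / 10     ≡⟨ m<n⇒m/n≡0 (s≤s (≤-trans (≤-reflexive (+-identityʳ (s j))) (s≤9 j))) ⟩
    0                  ∎

rows-carry-free⇔products≤9 : ∀ A B →
  (∀ k i → rowCarry A B k i ≡ 0) ⇔ (∀ k i → digit A i * digit B k ≤ 9)
rows-carry-free⇔products≤9 A B = mk⇔
  (λ r k → Equivalence.to (row k) (r k))
  (λ p k → Equivalence.from (row k) (p k))
  where
  row : ∀ k → (∀ i → rowCarry A B k i ≡ 0) ⇔ (∀ i → digit A i * digit B k ≤ 9)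
  row k = carry-free⇔columns≤9 (refl , λ i → refl)

-- When the rows are carry-free, the columns to be added are the coefficients
-- of P(A,x)P(B,x) (summed with the roles of A and B exchanged).
columnSum≡conv : ∀ A B → (∀ k i → digit A i * digit B k ≤ 9) →
  ∀ j → columnSum A B j ≡ conv (digit A) (digit B) j
columnSum≡conv A B p j = begin
  columnSum A B j                                            ≡⟨ cong sum (map-upTo _ (suc j)) ⟩
  sum (applyUpTo (λ k → rowDigit A B k (j ∸ k)) (suc j))     ≡⟨ sum-applyUpTo-cong (suc j) _ _ (λ k _ → rowDigit≡product k (j ∸ k)) ⟩
  sum (applyUpTo (λ k → digit B k * digit A (j ∸ k)) (suc j)) ≡⟨ conv-as-sum (digit B) (digit A) j ⟨
  conv (digit B) (digit A) j                                 ≡⟨ conv-comm (digit B) (digit A) j ⟩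
  conv (digit A) (digit B) j                                 ∎
  where
  rowDigit≡product : ∀ k i → rowDigit A B k i ≡ digit B k * digit A i
  rowDigit≡product k i
    rewrite Equivalence.from (rows-carry-free⇔products≤9 A B) p k i
          | +-identityʳ (digit A i * digit B k)
    = trans (m<n⇒m%n≡m (s≤s (p k i))) (*-comm (digit A i) (digit B k))

noCarry⇔coeffs≤9 : ∀ A B → NoCarry A B ⇔ CoeffsAtMost9 A B
noCarry⇔coeffs≤9 A B = mk⇔ coeffs≤9 noCarry
  where
  rows : (∀ k i → rowCarry A B k i ≡ 0) ⇔ (∀ k i → digit A i * digit B k ≤ 9)
  rows = rows-carry-free⇔products≤9 A B
  final : (∀ j → addCarry A B j ≡ 0) ⇔ (∀ j → columnSum A B j ≤ 9)
  final = carry-free⇔columns≤9 {columnSum A B} {addCarry A B} (refl , λ j → refl)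
  coeffs≤9 : NoCarry A B → CoeffsAtMost9 A B
  coeffs≤9 (r , a) j = subst (_≤ 9) (columnSum≡conv A B (Equivalence.to rows r) j) (Equivalence.to final a j)
  noCarry : CoeffsAtMost9 A B → NoCarry A B
  noCarry c = Equivalence.from rows products≤9 , Equivalence.from final columns≤9
    where
    products≤9 : ∀ k i → digit A i * digit B k ≤ 9
    products≤9 k i = ≤-trans (term≤conv (digit A) (digit B) i k) (c (i + k))
    columns≤9 : ∀ j → columnSum A B j ≤ 9
    columns≤9 j = subst (_≤ 9) (sym (columnSum≡conv A B products≤9 j)) (c j)

-- The theorem.
proposition1 : (A B : ℕ) → 0 < A → 0 < B →
    (PolynomialPair A B ⇔ NoCarry A B) × (NoCarry A B ⇔ CoeffsAtMost9 A B)
proposition1 A B _ _ =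
  ⇔-trans (polynomialPair⇔coeffs≤9 A B) (⇔-sym (noCarry⇔coeffs≤9 A B)) ,
  noCarry⇔coeffs≤9 A B
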